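{- Let $r\ge 2$ be an integer, let $\varphi$ be an instance of \textsc{2-Clause 3-SAT}, and let $G(\varphi)$ be the graph constructed from $\varphi$ as described in the context. If $\mathrm{col}_r(G(\varphi))\le 6$, then $\varphi$ has a satisfying assignment.
   Context: \textsc{2-Clause 3-SAT}: a CNF formula $\varphi$ with clauses $c_1,\dots,c_m$ over variables $x_1,\dots,x_n$, each clause containing at most 3 variables, each literal ($x_j$ or $\overline{x}_j$) appearing in exactly 2 clauses; it is assumed no variable appears twice in a clause and every clause has 2 or 3 literals. An $\ell$-subdivided edge between $a$ and $b$ is an induced path with $\ell$ new internal vertices (with no other neighbours) joining $a$ and $b$. Construction of $G(\varphi)$: a clause vertex $u_i$ for each clause $c_i$; for each variable $x_j$ two adjacent literal vertices $v_j$ (for $x_j$) and $v_j'$ (for $\overline{x}_j$); for each clause $c_i$ containing $x_j$ (resp. $\overline{x}_j$) join $u_i$ and $v_j$ (resp. $v_j'$) by an $(r-1)$-subdivided edge. Add a 7-clique on new vertices $w_1,\dots,w_7$; make every $u_i$ adjacent to $w_1,\dots,w_4$, and additionally to $w_5$ if $c_i$ has only 2 literals; make every $v_j$ adjacent to $w_2,w_3,w_4$ and every $v_j'$ adjacent to $w_5,w_6,w_7$. Coloring number: for a total order $\sigma$ on $V(G)$ and $u\neq v$, $v$ is $r$-reachable from $u$ if $v\not<_\sigma u$ and there is a $u$-$v$ path $P$ of length at most $r$ whose internal vertices $p$ all satisfy $p<_\sigma u$; $\mathrm{reach}_r(u,G_\sigma)$ is the set of such $v$, and $\mathrm{col}_r(G)=\min_\sigma\max_u|\mathrm{reach}_r(u,G_\sigma)|$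 over total orders $\sigma$. -}

module Defs where

open import Data.Nat using (ℕ; zero; suc; _≤_; _<_; _∸_)
open import Data.Fin using (Fin; toℕ; #_)
open import Data.Bool using (Bool; true; false)
open import Data.List using (List; []; _∷_; _++_; [_]; length; map; lookup)
open import Data.List.Membership.Propositional using (_∈_)
open import Data.List.Relation.Unary.All using (All)
open import Data.List.Relation.Unary.Unique.Propositional using (Unique)
open import Data.List.Relation.Unary.Linked using (Linked)
open import Data.Product using (Σ; ∃; _×_; _,_; proj₁; proj₂)
open import Data.Sum using (_⊎_)
open import Relation.Binary.PropositionalEquality using (_≡_; _≢_)
open import Function.Definitions using (Injective)

-- A graph: a vertex type with an (arbitrary) adjacency relation.
-- Edges are used symmetrically below (adjacency is symmetrised).
record Graph : Set₁ where
  field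
    V   : Set
    Adj : V → V → Set

module _ (G : Graph) where
  open Graph G

  IsPath : V → V → List V → Set
  IsPath u v xs = Linked Adj (u ∷ xs ++ [ v ]) × Unique (u ∷ xs ++ [ v ])

  -- A total order σ on V is given by an injective ranking V → ℕ
  -- (a <σ b  iff  rank a < rank b).  Every total order on a finite set
  -- arises this way.
  -- v is r-reachable from u w.r.t. σ: u ≠ v, v ≮σ u, and there is a
  -- u-v path of length ≤ r (number of edges = |internal| + 1) whose internal
  -- vertices are all <σ u.
  Reach : ℕ → (V → ℕ) → V → V → Set
  Reach r rank u v =
    u ≢ v × rank u ≤ rank v ×
    ∃ λ (xs : List V) → IsPath u v xs × suc (length xs) ≤ r ×
                          All (λ p → rank p < rank u) xs

  ColLe : ℕ → ℕ → Set
  ColLe r k = Σ (V → ℕ) λ rank → Injective _≡_ _≡_ rank ×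
    ((u : V) (ys : List V) → Unique ys → All (Reach r rank u) ys → length ys ≤ k)

-- A literal over variables Fin n: (j , true) is x_j, (j , false) is ¬x_j.
Literal : ℕ → Set
Literal n = Fin n × Bool

record Formula : Set where
  field
    nvars    : ℕ
    nclauses : ℕ
    clause   : Fin nclauses → List (Literal nvars)
open Formula public

Is2Clause3SAT : Formula → Set
Is2Clause3SAT φ =
  (∀ i → length (clause φ i) ≡ 2 ⊎ length (clause φ i) ≡ 3) ×
  (∀ i → Unique (map proj₁ (clause φ i))) ×
  (∀ (l : Literal (nvars φ)) → ∃ λ i₁ → ∃ λ i₂ →
      i₁ ≢ i₂ × l ∈ clause φ i₁ × l ∈ clause φ i₂ ×
      (∀ i → l ∈ clause φ i → i ≡ i₁ ⊎ i ≡ i₂))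

Satisfies : (φ : Formula) → (Fin (nvars φ) → Bool) → Set
Satisfies φ a = ∀ i → ∃ λ l → l ∈ clause φ i × a (proj₁ l) ≡ proj₂ l

Satisfiable : Formula → Set
Satisfiable φ = ∃ λ a → Satisfies φ a

module Construction (φ : Formula) (r : ℕ) where

  n = nvars φ
  m = nclauses φ

  -- number of internal vertices of each subdivided edge
  s : ℕ
  s = r ∸ 1

  data Vtx : Set where
    cl  : Fin m → Vtx
    lit : Fin n → Bool → Vtx                -- lit j true = v_j, lit j false = v_j'
    w   : Fin 7 → Vtx                       -- w (# 0) = w_1, …, w (# 6) = w_7
    sub : (i : Fin m) → Fin (length (clause φ i)) → Fin s → Vtx
      -- internal vertices of the subdivided edge from u_i to the literal
      -- vertex of the k-th literal of c_i

  litV : Literal n → Vtx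
  litV (j , b) = lit j b

  data Edge : Vtx → Vtx → Set where
    -- subdivided edges u_i — sub i k 0 — … — sub i k (s-1) — literal vertex
    sub-first : ∀ i k (t : Fin s) → toℕ t ≡ 0 → Edge (cl i) (sub i k t)
    sub-next  : ∀ i k (t t' : Fin s) → toℕ t' ≡ suc (toℕ t) → Edge (sub i k t) (sub i k t')
    sub-last  : ∀ i k (t : Fin s) → suc (toℕ t) ≡ s → Edge (sub i k t) (litV (lookup (clause φ i) k))
    sub-none  : ∀ i k → s ≡ 0 → Edge (cl i) (litV (lookup (clause φ i) k))
    lit-lit   : ∀ j → Edge (lit j true) (lit j false)
    ww        : ∀ (a b : Fin 7) → a ≢ b → Edge (w a) (w b)
    cw1 : ∀ i → Edge (cl i) (w (# 0))
    cw2 : ∀ i → Edge (cl i) (w (# 1))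
    cw3 : ∀ i → Edge (cl i) (w (# 2))
    cw4 : ∀ i → Edge (cl i) (w (# 3))
    cw5 : ∀ i → length (clause φ i) ≡ 2 → Edge (cl i) (w (# 4))
    pw2 : ∀ j → Edge (lit j true) (w (# 1))
    pw3 : ∀ j → Edge (lit j true) (w (# 2))
    pw4 : ∀ j → Edge (lit j true) (w (# 3))
    nw5 : ∀ j → Edge (lit j false) (w (# 4))
    nw6 : ∀ j → Edge (lit j false) (w (# 5))
    nw7 : ∀ j → Edge (lit j false) (w (# 6))

  Adjacent : Vtx → Vtx → Set
  Adjacent u v = Edge u v ⊎ Edge v u

  graph : Graph
  graph = record { V = Vtx ; Adj = Adjacent }

G[_,_] : Formula → ℕ → Graph
G[ φ , r ] = Construction.graph φ r

-- Let w be the earliest vertex of the 7-clique. It already reaches the six other clique vertices,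
-- so every other neighbour of w, and every vertex two steps away through such a neighbour, comes
-- before w; hence either all clause vertices or all literal vertices precede the whole clique.
-- A clause vertex preceding all of its literal vertices would reach one vertex on each of its
-- subdivided edges besides its 4 (or 5) clique neighbours: seven vertices. So every clause has a
-- literal vertex placed before the clause vertex, and that literal vertex also precedes its
-- negation, for otherwise it reaches w_2, …, w_7 (three directly, three through the negation) and a
-- vertex on the path towards the clause. Hence x_j := [v_j before v_j'] satisfies every clause.

module Submission where

open import Defs
open import Data.Nat using (ℕ; zero; suc; _+_; _≤_; _<_; _<?_; z≤n; s≤s)
open import Data.Nat.Properties
  using (<-cmp; <-irrefl; <-asym; <-trans; <-≤-trans; <⇒≤; <⇒≢; ≤-trans; ≤-reflexive; ≤-pred; ≤-antisym
        ; ≮⇒≥; ≤⇒≯; ≤∧≢⇒<; 1+n≰n; m≤m+n)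
open import Data.List
  using (List; []; _∷_; _++_; [_]; length; map; lookup; filter; allFin; tabulate; applyUpTo; applyDownFrom)
open import Data.List.Properties
  using (++-assoc; ++-identityʳ; length-++; length-map; length-tabulate; length-applyUpTo
        ; length-applyDownFrom; applyUpTo-∷ʳ; applyDownFrom-∷ʳ)
open import Data.List.Membership.Propositional using (_∈_)
open import Data.List.Membership.Propositional.Properties
  using (∈-++⁺ˡ; ∈-++⁺ʳ; ∈-map⁺; ∈-map⁻; ∈-lookup; ∈-allFin; ∈-filter⁻; ∈-tabulate⁻; ∈-applyUpTo⁻
        ; ∈-applyDownFrom⁻)
open import Data.List.Relation.Unary.Any using (here; there)
open import Data.List.Relation.Unary.All as All using (All; []; _∷_)
import Data.List.Relation.Unary.All.Properties as All
open import Data.List.Relation.Unary.Linked using (Linked; []; [-]; _∷_)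
import Data.List.Relation.Unary.Linked.Properties as Linked
open import Data.List.Relation.Unary.AllPairs as AllPairs using ([]; _∷_)
open import Data.List.Relation.Unary.Unique.Propositional using (Unique)
open import Data.List.Relation.Binary.Disjoint.Propositional using (Disjoint)
import Data.List.Relation.Unary.Unique.Propositional.Properties as Unique
open import Data.Product using (∃; _×_; _,_; proj₁; proj₂)
open import Data.Empty using (⊥; ⊥-elim)
open import Data.Sum as Sum using (_⊎_; inj₁; inj₂)
open import Data.Bool using (Bool; true; false; not)
open import Data.Bool.Properties using (¬-not) renaming (_≟_ to _≟ᵇ_)
open import Data.Fin using (Fin; zero; suc; #_; toℕ; fromℕ<)
open import Data.Fin.Properties using (_≟_; toℕ-fromℕ<; any?)
open import Data.List.Extrema.Nat using (argmin; f[argmin]≤f[xs])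
open import Relation.Nullary using (¬_; ¬?; yes; no; does; contradiction)
open import Relation.Nullary.Decidable using (from-yes; dec-true; dec-false)
open import Data.List.Relation.Unary.Unique.DecPropositional (_≟_ {7}) using (unique?)
open import Function using (id; _∘_)
open import Function.Definitions using (Injective)
open import Relation.Binary using (tri<; tri≈; tri>)
open import Relation.Binary.PropositionalEquality using (_≡_; _≢_; refl; sym; trans; cong; cong₂; subst; subst₂)

Linked-++⁻ˡ : ∀ {A : Set} {R : A → A → Set} xs {ys} → Linked R (xs ++ ys) → Linked R xs
Linked-++⁻ˡ []           _          = []
Linked-++⁻ˡ (x ∷ [])     _          = [-]
Linked-++⁻ˡ (x ∷ y ∷ xs) (Rxy ∷ Rs) = Rxy ∷ Linked-++⁻ˡ (y ∷ xs) Rs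

Unique-++⁻ˡ : ∀ {A : Set} xs {ys : List A} → Unique (xs ++ ys) → Unique xs
Unique-++⁻ˡ []       _          = []
Unique-++⁻ˡ (x ∷ xs) (x∉ ∷ xs!) = All.++⁻ˡ xs x∉ ∷ Unique-++⁻ˡ xs xs!

module _ {G : Graph} where
  open Graph G

  isPath-prefix : ∀ {u v x} ps xs → IsPath G u v (ps ++ x ∷ xs) → IsPath G u x ps
  isPath-prefix {u} {v} {x} ps xs (linked , unique) =
    Linked-++⁻ˡ (u ∷ ps ++ [ x ]) (subst (Linked Adj) split linked) ,
    Unique-++⁻ˡ (u ∷ ps ++ [ x ]) (subst Unique split unique)
    where
    split : u ∷ (ps ++ x ∷ xs) ++ [ v ] ≡ (u ∷ ps ++ [ x ]) ++ xs ++ [ v ]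
    split = cong (u ∷_) (trans (++-assoc ps (x ∷ xs) [ v ]) (sym (++-assoc ps [ x ] (xs ++ [ v ]))))

  applyUpTo-isPath : ∀ (f : ℕ → V) n →
    (∀ {i} → i ≤ n → Adj (f i) (f (suc i))) →
    (∀ {i j} → i < j → j ≤ suc n → f i ≢ f j) →
    IsPath G (f 0) (f (suc n)) (applyUpTo (f ∘ suc) n)
  applyUpTo-isPath f n adj distinct =
    subst (Linked Adj) whole (Linked.applyUpTo⁺₁ f (suc (suc n)) (adj ∘ ≤-pred ∘ ≤-pred)) ,
    subst Unique whole (Unique.applyUpTo⁺₁ f (suc (suc n)) (λ i<j j<n → distinct i<j (≤-pred j<n)))
    where
    whole : applyUpTo f (suc (suc n)) ≡ f 0 ∷ applyUpTo (f ∘ suc) n ++ [ f (suc n) ]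
    whole = cong (f 0 ∷_) (sym (applyUpTo-∷ʳ (f ∘ suc) n))

  applyDownFrom-isPath : ∀ (f : ℕ → V) n →
    (∀ {i} → i ≤ n → Adj (f (suc i)) (f i)) →
    (∀ {i j} → i < j → j ≤ suc n → f i ≢ f j) →
    IsPath G (f (suc n)) (f 0) (applyDownFrom (f ∘ suc) n)
  applyDownFrom-isPath f n adj distinct =
    subst (Linked Adj) whole (Linked.applyDownFrom⁺₁ f (suc (suc n)) (adj ∘ ≤-pred ∘ ≤-pred)) ,
    subst Unique whole (Unique.applyDownFrom⁺₁ f (suc (suc n)) (λ j<i i<n e → distinct j<i (≤-pred i<n) (sym e)))
    where
    whole : applyDownFrom f (suc (suc n)) ≡ f (suc n) ∷ applyDownFrom (f ∘ suc) n ++ [ f 0 ]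
    whole = cong (f (suc n) ∷_) (sym (applyDownFrom-∷ʳ f n))

module _ {G : Graph} (rank : Graph.V G → ℕ) where
  open Graph G

  rank-apart : ∀ {u v} → rank u < rank v → u ≢ v
  rank-apart u<v u≡v = <-irrefl (cong rank u≡v) u<v

  reach-edge : ∀ {r u v} → 1 ≤ r → Adj u v → rank u < rank v → Reach G r rank u v
  reach-edge r≥1 uv u<v =
    rank-apart u<v , <⇒≤ u<v , [] , (uv ∷ [-] , (rank-apart u<v ∷ []) ∷ [] ∷ []) , r≥1 , []

  reach-via : ∀ {r u p v} → 2 ≤ r → Adj u p → Adj p v → rank p < rank u → rank u < rank v →
              Reach G r rank u v
  reach-via r≥2 up pv p<u u<v =
    rank-apart u<v , <⇒≤ u<v , _ ∷ [] ,
    (up ∷ pv ∷ [-] ,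
     (rank-apart p<u ∘ sym ∷ rank-apart u<v ∷ []) ∷ (rank-apart (<-trans p<u u<v) ∷ []) ∷ [] ∷ []) ,
    r≥2 , p<u ∷ []

  -- The first vertex of the path that comes after u in the order is reached through earlier vertices.
  reach-first-later : Injective _≡_ _≡_ rank → ∀ {r u v} xs → IsPath G u v xs →
    suc (length xs) ≤ r → rank u < rank v → ∃ λ z → z ∈ xs ++ [ v ] × Reach G r rank u z
  reach-first-later rank-inj {r} {u} {v} xs path = go [] xs path []
    where
    go : ∀ ps xs → IsPath G u v (ps ++ xs) → All (λ p → rank p < rank u) ps →
         suc (length (ps ++ xs)) ≤ r → rank u < rank v → ∃ λ z → z ∈ xs ++ [ v ] × Reach G r rank u z
    go ps [] path earlier short u<v =
      v , here refl ,
      rank-apart u<v , <⇒≤ u<v , ps , subst (IsPath G u v) (++-identityʳ ps) path ,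
      subst (λ xs → suc (length xs) ≤ r) (++-identityʳ ps) short , earlier
    go ps (x ∷ xs) path earlier short u<v with <-cmp (rank x) (rank u)
    ... | tri< x<u _ _ =
      let z , z∈ , reach = go (ps ++ [ x ]) xs (subst (IsPath G u v) shift path)
                              (All.∷ʳ⁺ earlier x<u) (subst (λ xs → suc (length xs) ≤ r) shift short) u<v
      in z , there z∈ , reach
      where
      shift : ps ++ x ∷ xs ≡ (ps ++ [ x ]) ++ xs
      shift = sym (++-assoc ps [ x ] xs)
    ... | tri≈ _ x≈u _ = ⊥-elim (All.lookup u∉ (∈-++⁺ˡ (∈-++⁺ʳ ps (here refl))) (sym (rank-inj x≈u)))
      where u∉ = AllPairs.head (proj₂ path)
    ... | tri> _ _ u<x =
      x , here refl ,
      rank-apart u<x , <⇒≤ u<x , ps , isPath-prefix ps xs path ,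
      ≤-trans (s≤s (subst (length ps ≤_) (sym (length-++ ps)) (m≤m+n _ _))) short , earlier

lookup-injective : ∀ {A B : Set} (f : A → B) xs {k k' : Fin (length xs)} →
  Unique (map f xs) → f (lookup xs k) ≡ f (lookup xs k') → k ≡ k'
lookup-injective f (x ∷ xs) {zero}  {zero}   _          _ = refl
lookup-injective f (x ∷ xs) {zero}  {suc k'} (fx∉ ∷ _)  e =
  contradiction e (All.lookup fx∉ (∈-map⁺ f (∈-lookup k')))
lookup-injective f (x ∷ xs) {suc k} {zero}   (fx∉ ∷ _)  e =
  contradiction (sym e) (All.lookup fx∉ (∈-map⁺ f (∈-lookup k)))
lookup-injective f (x ∷ xs) {suc k} {suc k'} (_ ∷ fxs!) e = cong suc (lookup-injective f xs fxs! e)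

negate : ∀ {n} → Literal n → Literal n
negate (j , b) = j , not b

module Reduction (t : ℕ) (φ : Formula)
  (clause-size : ∀ i → length (clause φ i) ≡ 2 ⊎ length (clause φ i) ≡ 3)
  (clause-vars-distinct : ∀ i → Unique (map proj₁ (clause φ i)))
  (rank : Construction.Vtx φ (2 + t) → ℕ) (rank-inj : Injective _≡_ _≡_ rank)
  (at-most-six : ∀ u ys → Unique ys → All (Reach G[ φ , 2 + t ] (2 + t) rank u) ys → length ys ≤ 6)
  where
  open Construction φ (2 + t)

  _≺_ : Vtx → Vtx → Set
  x ≺ y = rank x < rank y

  Reaches : Vtx → Vtx → Set
  Reaches = Reach graph (2 + t) rank

  NotW : Vtx → Set
  NotW z = ∀ c → z ≢ w c

  BelowAllW : Vtx → Set
  BelowAllW x = ∀ c → x ≺ w c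

  ≺-connex : ∀ {x y} → x ≢ y → x ≺ y ⊎ y ≺ x
  ≺-connex {x} {y} x≢y with <-cmp (rank x) (rank y)
  ... | tri< x≺y _ _ = inj₁ x≺y
  ... | tri≈ _ x≈y _ = contradiction (rank-inj x≈y) x≢y
  ... | tri> _ _ y≺x = inj₂ y≺x

  adj-sym : ∀ {x y} → Adjacent x y → Adjacent y x
  adj-sym = Sum.swap

  reach-edge′ : ∀ {x y} → Adjacent x y → x ≺ y → Reaches x y
  reach-edge′ = reach-edge rank (s≤s z≤n)

  reach-via′ : ∀ {x p y} → Adjacent x p → Adjacent p y → p ≺ x → x ≺ y → Reaches x y
  reach-via′ = reach-via rank (s≤s (s≤s z≤n))

  no-seven-reached : ∀ {u} ys → length ys ≡ 7 → Unique ys → All (Reaches u) ys → ⊥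
  no-seven-reached ys seven ys! reached = 1+n≰n (subst (_≤ 6) seven (at-most-six _ ys ys! reached))

  reach-saturated : ∀ {u z} ys → length ys ≡ 6 → Unique ys → All (Reaches u) ys → All (z ≢_) ys →
                    ¬ Reaches u z
  reach-saturated ys six ys! reached z∉ reach =
    no-seven-reached (_ ∷ ys) (cong suc six) (z∉ ∷ ys!) (reach ∷ reached)

  w-injective : ∀ {c d} → w c ≡ w d → c ≡ d
  w-injective refl = refl

  NotW-apart : ∀ {z} → NotW z → ∀ cs → All (z ≢_) (map w cs)
  NotW-apart z-not-w cs = All.map⁺ (All.universal z-not-w cs)

  otherWs : Fin 7 → List (Fin 7)
  otherWs c = filter (λ d → ¬? (d ≟ c)) (allFin 7)

  otherWs-length : ∀ c → length (otherWs c) ≡ 6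
  otherWs-length zero                                     = refl
  otherWs-length (suc zero)                               = refl
  otherWs-length (suc (suc zero))                         = refl
  otherWs-length (suc (suc (suc zero)))                   = refl
  otherWs-length (suc (suc (suc (suc zero))))             = refl
  otherWs-length (suc (suc (suc (suc (suc zero)))))       = refl
  otherWs-length (suc (suc (suc (suc (suc (suc zero)))))) = refl

  litWs : Bool → List (Fin 7)
  litWs true  = # 1 ∷ # 2 ∷ # 3 ∷ []
  litWs false = # 4 ∷ # 5 ∷ # 6 ∷ []

  litWs-cover : ∀ c → c ≢ # 0 → ∃ λ b → c ∈ litWs b
  litWs-cover zero                                     c≢0 = contradiction refl c≢0
  litWs-cover (suc zero)                               _   = true  , here refl
  litWs-cover (suc (suc zero))                         _   = true  , there (here refl)
  litWs-cover (suc (suc (suc zero)))                   _   = true  , there (there (here refl))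
  litWs-cover (suc (suc (suc (suc zero))))             _   = false , here refl
  litWs-cover (suc (suc (suc (suc (suc zero)))))       _   = false , there (here refl)
  litWs-cover (suc (suc (suc (suc (suc (suc zero)))))) _   = false , there (there (here refl))

  litWs-unique : ∀ b → Unique (litWs b ++ litWs (not b))
  litWs-unique true  = from-yes (unique? (litWs true ++ litWs false))
  litWs-unique false = from-yes (unique? (litWs false ++ litWs true))

  lit-w-adj : ∀ j b {c} → c ∈ litWs b → Adjacent (lit j b) (w c)
  lit-w-adj j true  (here refl)                 = inj₁ (pw2 j)
  lit-w-adj j true  (there (here refl))         = inj₁ (pw3 j)
  lit-w-adj j true  (there (there (here refl))) = inj₁ (pw4 j)
  lit-w-adj j false (here refl)                 = inj₁ (nw5 j)
  lit-w-adj j false (there (here refl))         = inj₁ (nw6 j)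
  lit-w-adj j false (there (there (here refl))) = inj₁ (nw7 j)

  lit-lit-adj : ∀ j b → Adjacent (lit j b) (lit j (not b))
  lit-lit-adj j true  = inj₁ (lit-lit j)
  lit-lit-adj j false = inj₂ (lit-lit j)

  clauseWs : Fin m → List (Fin 7)
  clauseWs i with clause-size i
  ... | inj₁ _ = # 0 ∷ # 1 ∷ # 2 ∷ # 3 ∷ # 4 ∷ []
  ... | inj₂ _ = # 0 ∷ # 1 ∷ # 2 ∷ # 3 ∷ []

  clauseWs-length : ∀ i → length (clause φ i) + length (clauseWs i) ≡ 7
  clauseWs-length i with clause-size i
  ... | inj₁ two   = cong (_+ 5) two
  ... | inj₂ three = cong (_+ 4) three

  clauseWs-unique : ∀ i → Unique (clauseWs i)
  clauseWs-unique i with clause-size i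
  ... | inj₁ _ = from-yes (unique? (# 0 ∷ # 1 ∷ # 2 ∷ # 3 ∷ # 4 ∷ []))
  ... | inj₂ _ = from-yes (unique? (# 0 ∷ # 1 ∷ # 2 ∷ # 3 ∷ []))

  clause-w-adj : ∀ i {c} → c ∈ clauseWs i → Adjacent (cl i) (w c)
  clause-w-adj i with clause-size i
  ... | inj₁ two = λ where
    (here refl)                                 → inj₁ (cw1 i)
    (there (here refl))                         → inj₁ (cw2 i)
    (there (there (here refl)))                 → inj₁ (cw3 i)
    (there (there (there (here refl))))         → inj₁ (cw4 i)
    (there (there (there (there (here refl))))) → inj₁ (cw5 i two)
  ... | inj₂ _ = λ where
    (here refl)                         → inj₁ (cw1 i)
    (there (here refl))                 → inj₁ (cw2 i)
    (there (there (here refl)))         → inj₁ (cw3 i)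
    (there (there (there (here refl)))) → inj₁ (cw4 i)

  clause-nonempty : ∀ i → 0 < length (clause φ i)
  clause-nonempty i = Sum.[ (λ two → subst (0 <_) (sym two) (s≤s z≤n)) ,
                            (λ three → subst (0 <_) (sym three) (s≤s z≤n)) ]′ (clause-size i)

  L : (i : Fin m) → Fin (length (clause φ i)) → Vtx
  L i k = litV (lookup (clause φ i) k)

  -- spoke i k q is the q-th vertex of the subdivided edge from u_i (q = 0) to L i k (q = s + 1).
  spoke : (i : Fin m) → Fin (length (clause φ i)) → ℕ → Vtx
  spoke i k zero = cl i
  spoke i k (suc q) with q <? s
  ... | yes q<s = sub i k (fromℕ< q<s)
  ... | no _    = L i k

  spoke-end : ∀ i k → spoke i k (suc s) ≡ L i k
  spoke-end i k with s <? s
  ... | yes s<s = contradiction s<s (<-irrefl refl)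
  ... | no _    = refl

  spoke-adj : ∀ i k {q} → q ≤ s → Adjacent (spoke i k q) (spoke i k (suc q))
  spoke-adj i k {zero} _ with 0 <? s
  ... | yes 0<s = inj₁ (sub-first i k (fromℕ< 0<s) (toℕ-fromℕ< 0<s))
  ... | no 0≮s  = contradiction (s≤s z≤n) 0≮s
  spoke-adj i k {suc q} q<s′ with q <? s | suc q <? s
  ... | yes q<s | yes q+1<s =
    inj₁ (sub-next i k _ _ (trans (toℕ-fromℕ< q+1<s) (cong suc (sym (toℕ-fromℕ< q<s)))))
  ... | yes q<s | no q+1≮s  =
    inj₁ (sub-last i k _ (trans (cong suc (toℕ-fromℕ< q<s)) (≤-antisym q<s (≮⇒≥ q+1≮s))))
  ... | no q≮s  | _         = contradiction q<s′ q≮s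

  spoke-injective : ∀ i k {p q} → p < q → q ≤ suc s → spoke i k p ≢ spoke i k q
  spoke-injective i k {zero} {suc q} _ _ with q <? s
  ... | yes _ = λ ()
  ... | no _  = λ ()
  spoke-injective i k {suc p} {suc q} p<q q≤s with p <? s | q <? s
  ... | yes p<s | yes q<s = λ e →
    <⇒≢ (≤-pred p<q) (trans (sym (toℕ-fromℕ< p<s)) (trans (cong toℕ (sub-injective e)) (toℕ-fromℕ< q<s)))
    where sub-injective : ∀ {k t t′} → sub i k t ≡ sub i k t′ → t ≡ t′
          sub-injective refl = refl
  ... | yes _   | no _    = λ ()
  ... | no _    | yes _   = λ ()
  ... | no p≮s  | no _    = contradiction (≤-trans p<q q≤s) (≤⇒≯ (≮⇒≥ p≮s) ∘ ≤-pred)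

  spoke-not-w : ∀ i k q → NotW (spoke i k q)
  spoke-not-w i k zero c = λ ()
  spoke-not-w i k (suc q) c with q <? s
  ... | yes _ = λ ()
  ... | no _  = λ ()

  spokes-apart : ∀ i {k k′} p p′ → k ≢ k′ → spoke i k (suc p) ≢ spoke i k′ (suc p′)
  spokes-apart i p p′ k≢k′ with p <? s | p′ <? s
  ... | yes _ | yes _ = k≢k′ ∘ same-position
    where same-position : ∀ {k k′ t t′} → sub i k t ≡ sub i k′ t′ → k ≡ k′
          same-position refl = refl
  ... | yes _ | no _  = λ ()
  ... | no _  | yes _ = λ ()
  ... | no _  | no _  = k≢k′ ∘ lookup-injective proj₁ (clause φ i) (clause-vars-distinct i) ∘ same-variable
    where same-variable : ∀ {j j′ b b′} → lit j b ≡ lit j′ b′ → j ≡ j′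
          same-variable refl = refl

  clause-reaches-spoke : ∀ i k → cl i ≺ L i k → ∃ λ p → Reaches (cl i) (spoke i k (suc p))
  clause-reaches-spoke i k cl≺L =
    let z , z∈ , reach =
          reach-first-later rank rank-inj _ path short (subst (cl i ≺_) (sym (spoke-end i k)) cl≺L)
        p , _ , z≡ = ∈-applyUpTo⁻ (spoke i k ∘ suc) (subst (z ∈_) (applyUpTo-∷ʳ (spoke i k ∘ suc) s) z∈)
    in p , subst (Reaches (cl i)) z≡ reach
    where
    path  = applyUpTo-isPath (spoke i k) s (spoke-adj i k) (spoke-injective i k)
    short = ≤-reflexive (cong suc (length-applyUpTo (spoke i k ∘ suc) s))

  literal-reaches-non-w : ∀ i k → L i k ≺ cl i → ∃ λ z → NotW z × Reaches (L i k) z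
  literal-reaches-non-w i k L≺cl =
    let z , z∈ , reach =
          reach-first-later rank rank-inj _ path short (subst (_≺ cl i) (sym (spoke-end i k)) L≺cl)
        p , _ , z≡ = ∈-applyDownFrom⁻ (spoke i k) (subst (z ∈_) (applyDownFrom-∷ʳ (spoke i k) s) z∈)
    in spoke i k p , spoke-not-w i k p , subst₂ Reaches (spoke-end i k) z≡ reach
    where
    path  = applyDownFrom-isPath (spoke i k) s (adj-sym ∘ spoke-adj i k) (spoke-injective i k)
    short = ≤-reflexive (cong suc (length-applyDownFrom (spoke i k ∘ suc) s))

  literal-not-clause : ∀ l {i} → litV l ≢ cl i
  literal-not-clause (j , b) ()

  literal-not-negation : ∀ l → litV l ≢ litV (negate l)
  literal-not-negation (j , true)  ()
  literal-not-negation (j , false) ()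

  late-literal-reaches-only-w : ∀ l {z} → litV (negate l) ≺ litV l → BelowAllW (litV l) → NotW z →
                                ¬ Reaches (litV l) z
  late-literal-reaches-only-w (j , b) late below z-not-w =
    reach-saturated (map w (litWs b ++ litWs (not b))) (six b)
      (Unique.map⁺ w-injective (litWs-unique b))
      (All.map⁺ (All.++⁺ (All.tabulate λ c∈ → reach-edge′ (lit-w-adj j b c∈) (below _))
                         (All.tabulate λ c∈ → reach-via′ (lit-lit-adj j b) (lit-w-adj j (not b) c∈) late (below _))))
      (NotW-apart z-not-w (litWs b ++ litWs (not b)))
    where
    six : ∀ b → length (map w (litWs b ++ litWs (not b))) ≡ 6
    six true  = refl
    six false = refl

  clause-cannot-reach-every-spoke : ∀ i (depth : Fin (length (clause φ i)) → ℕ) → BelowAllW (cl i) →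
    ¬ (∀ k → Reaches (cl i) (spoke i k (suc (depth k))))
  clause-cannot-reach-every-spoke i depth below reach =
    no-seven-reached (zs ++ map w (clauseWs i)) seven unique reaches
    where
    zs = tabulate λ k → spoke i k (suc (depth k))

    seven : length (zs ++ map w (clauseWs i)) ≡ 7
    seven = trans (length-++ zs)
              (trans (cong₂ _+_ (length-tabulate _) (length-map w (clauseWs i))) (clauseWs-length i))

    reached-injective : ∀ {k k′} → spoke i k (suc (depth k)) ≡ spoke i k′ (suc (depth k′)) → k ≡ k′
    reached-injective {k} {k′} e with k ≟ k′
    ... | yes k≡k′ = k≡k′
    ... | no k≢k′  = contradiction e (spokes-apart i (depth k) (depth k′) k≢k′)

    disjoint : Disjoint zs (map w (clauseWs i))
    disjoint (v∈zs , v∈ws) with ∈-tabulate⁻ v∈zs | ∈-map⁻ w v∈ws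
    ... | k , refl | c , _ , e = spoke-not-w i k (suc (depth k)) c e

    unique : Unique (zs ++ map w (clauseWs i))
    unique = Unique.++⁺ (Unique.tabulate⁺ reached-injective)
                        (Unique.map⁺ w-injective (clauseWs-unique i)) disjoint

    reaches : All (Reaches (cl i)) (zs ++ map w (clauseWs i))
    reaches = All.++⁺ (All.tabulate⁺ reach)
                      (All.map⁺ (All.tabulate λ c∈ → reach-edge′ (clause-w-adj i c∈) (below _)))

  assignment : Fin n → Bool
  assignment j = does (rank (lit j true) <? rank (lit j false))

  assignment-earlier : ∀ l → litV l ≺ litV (negate l) → assignment (proj₁ l) ≡ proj₂ l
  assignment-earlier (j , true)  earlier = dec-true (rank (lit j true) <? rank (lit j false)) earlier
  assignment-earlier (j , false) earlier = dec-false (rank (lit j true) <? rank (lit j false)) (<-asym earlier)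

  module _ (first : Fin 7) (first-minimal : ∀ c → rank (w first) ≤ rank (w c)) where

    first-reaches-only-w : ∀ {z} → NotW z → ¬ Reaches (w first) z
    first-reaches-only-w z-not-w =
      reach-saturated (map w (otherWs first))
        (trans (length-map w (otherWs first)) (otherWs-length first))
        (Unique.map⁺ w-injective (Unique.filter⁺ (λ d → ¬? (d ≟ first)) (Unique.allFin⁺ 7)))
        (All.map⁺ (All.tabulate reach-other))
        (NotW-apart z-not-w (otherWs first))
      where
      reach-other : ∀ {c} → c ∈ otherWs first → Reaches (w first) (w c)
      reach-other {c} c∈ =
        reach-edge′ (inj₁ (ww first c (c≢first ∘ sym)))
                    (≤∧≢⇒< (first-minimal c) (c≢first ∘ w-injective ∘ rank-inj ∘ sym))
        where c≢first = proj₂ (∈-filter⁻ (λ d → ¬? (d ≟ first)) {xs = allFin 7} c∈)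

    below-first : ∀ {x} → NotW x → Adjacent (w first) x → x ≺ w first
    below-first {x} x-not-w wx with ≺-connex (x-not-w first)
    ... | inj₁ x≺first = x≺first
    ... | inj₂ first≺x = contradiction (reach-edge′ wx first≺x) (first-reaches-only-w x-not-w)

    below-first² : ∀ {y x} → NotW y → NotW x → Adjacent (w first) y → Adjacent y x → x ≺ w first
    below-first² {y} {x} y-not-w x-not-w wy yx with ≺-connex (x-not-w first)
    ... | inj₁ x≺first = x≺first
    ... | inj₂ first≺x =
      contradiction (reach-via′ wy yx (below-first y-not-w wy) first≺x) (first-reaches-only-w x-not-w)

    literals-below-first : first ≢ # 0 → ∀ l → litV l ≺ w first
    literals-below-first first≢0 (j , b) with litWs-cover first first≢0
    ... | b₀ , first∈ with b ≟ᵇ b₀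
    ...   | yes refl = below-first (λ _ ()) (adj-sym (lit-w-adj j b first∈))
    ...   | no b≢b₀  =
      below-first² (λ _ ()) (λ _ ()) (adj-sym (lit-w-adj j b₀ first∈))
        (subst (Adjacent (lit j b₀) ∘ lit j) (sym (¬-not b≢b₀)) (lit-lit-adj j b₀))

    clauses-below-first : first ≡ # 0 → ∀ i → cl i ≺ w first
    clauses-below-first refl i = below-first (λ _ ()) (inj₂ (cw1 i))

    endpoint-below-first : ∀ i k → cl i ≺ w first ⊎ L i k ≺ w first
    endpoint-below-first i k with first ≟ # 0
    ... | yes first≡0 = inj₁ (clauses-below-first first≡0 i)
    ... | no first≢0  = inj₂ (literals-below-first first≢0 _)

    earlier-below-all-w : ∀ {x y} → x ≺ y → x ≺ w first ⊎ y ≺ w first → BelowAllW x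
    earlier-below-all-w x≺y below c = <-≤-trans (Sum.[ id , <-trans x≺y ]′ below) (first-minimal c)

    late-literal-after-clause : ∀ i k → litV (negate (lookup (clause φ i) k)) ≺ L i k → cl i ≺ L i k
    late-literal-after-clause i k late with ≺-connex (literal-not-clause _ ∘ sym)
    ... | inj₁ cl≺L = cl≺L
    ... | inj₂ L≺cl with literal-reaches-non-w i k L≺cl
    ...   | z , z-not-w , reach =
      contradiction reach
        (late-literal-reaches-only-w _ late L-below z-not-w)
      where L-below = earlier-below-all-w L≺cl (Sum.swap (endpoint-below-first i k))

    clause-not-before-all-literals : ∀ i → ¬ (∀ k → cl i ≺ L i k)
    clause-not-before-all-literals i early =
      clause-cannot-reach-every-spoke i (proj₁ ∘ reach) below (proj₂ ∘ reach)
      where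
      reach : ∀ k → ∃ λ p → Reaches (cl i) (spoke i k (suc p))
      reach k = clause-reaches-spoke i k (early k)

      below : BelowAllW (cl i)
      below = earlier-below-all-w (early k₀) (endpoint-below-first i k₀)
        where k₀ = fromℕ< (clause-nonempty i)

    clause-has-earlier-literal : ∀ i → ∃ λ k → L i k ≺ cl i
    clause-has-earlier-literal i with any? (λ k → rank (L i k) <? rank (cl i))
    ... | yes found = found
    ... | no none   = contradiction (λ k → Sum.[ (λ L≺cl → contradiction (k , L≺cl) none) , id ]′
                                              (≺-connex (literal-not-clause _)))
                                    (clause-not-before-all-literals i)

    earlier-literal-precedes-negation : ∀ i k → L i k ≺ cl i → L i k ≺ litV (negate (lookup (clause φ i) k))
    earlier-literal-precedes-negation i k L≺cl with ≺-connex (literal-not-negation _)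
    ... | inj₁ earlier = earlier
    ... | inj₂ late    = contradiction (late-literal-after-clause i k late) (<-asym L≺cl)

    satisfies : Satisfies φ assignment
    satisfies i =
      let k , L≺cl = clause-has-earlier-literal i
      in lookup (clause φ i) k , ∈-lookup k , assignment-earlier _ (earlier-literal-precedes-negation i k L≺cl)

  satisfiable : Satisfiable φ
  satisfiable = assignment , satisfies first first-minimal
    where
    first : Fin 7
    first = argmin (rank ∘ w) zero (allFin 7)

    first-minimal : ∀ c → rank (w first) ≤ rank (w c)
    first-minimal c = All.lookup (f[argmin]≤f[xs] {f = rank ∘ w} zero (allFin 7)) (∈-allFin c)

lemma6 : (r : ℕ) → 2 ≤ r → (φ : Formula) → Is2Clause3SAT φ →
           ColLe G[ φ , r ] r 6 → Satisfiable φ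
lemma6 (suc (suc t)) _ φ (clause-size , clause-vars-distinct , _) (rank , rank-inj , at-most-six) =
  Reduction.satisfiable t φ clause-size clause-vars-distinct rank rank-inj at-most-six
lemma6 (suc zero) (s≤s ()) _ _ _
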